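{- Let $G$ be a graph such that $\gamma_{t2}(G) \geq 3$. If $G$ has a minimum semitotal dominating set $D$ such that (i) $D$ contains two adjacent vertices, or (ii) there exists $x \in D$ with $|w_D(x)| \geq 2$, then $ct_{\gamma_{t2}}(G) \leq 2$.
   Context: All graphs are finite and simple (and connected). A semitotal dominating set of $G$ is a set $D\subseteq V(G)$ such that every vertex of $V(G)\setminus D$ has a neighbour in $D$ and every vertex of $D$ is at distance at most two from another vertex of $D$; $\gamma_{t2}(G)$ is its minimum size. For $x\in D$, a witness for $x$ is a vertex $y\in D$, $y\neq x$, with $d(x,y)\le 2$; $w_D(x)$ is the set of witnesses of $x$. The contraction of an edge $xy$ removes $x,y$ and adds a new vertex adjacent to all former neighbours of $x$ or $y$ (no loops/multi-edges). $ct_{\gamma_{t2}}(G)$ is the minimum number of edge contractions needed to transform $G$ into a graph $H$ with $\gamma_{t2}(H)=\gamma_{t2}(G)-1$. -}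

module Defs where

open import Level using (Level) renaming (suc to lsuc; zero to lzero)
open import Data.Nat using (ℕ; zero; suc; _≤_)
open import Data.Fin using (Fin)
open import Data.Fin.Subset using (Subset; _∈_; _∉_; ∣_∣)
open import Data.Product using (Σ; ∃; ∃-syntax; _×_; _,_)
open import Data.Sum using (_⊎_)
open import Relation.Nullary using (¬_)
open import Relation.Binary using (Decidable)
open import Relation.Binary.PropositionalEquality using (_≡_; _≢_)
open import Function.Bundles using (_⇔_)

record Graph (n : ℕ) : Set₁ where
  field
    Adj    : Fin n → Fin n → Set
    adj?   : Decidable Adj
    sym    : ∀ {u v} → Adj u v → Adj v u
    irrefl : ∀ {u} → ¬ Adj u u
open Graph public

data Reach {n : ℕ} (G : Graph n) : Fin n → Fin n → Set where
  here : ∀ {u} → Reach G u u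
  step : ∀ {u v w} → Adj G u v → Reach G v w → Reach G u w

Connected : {n : ℕ} → Graph n → Set
Connected G = ∀ u v → Reach G u v

Dist≤2 : {n : ℕ} → Graph n → Fin n → Fin n → Set
Dist≤2 G x y = Adj G x y ⊎ (∃[ z ] (Adj G x z × Adj G z y))

Witness : {n : ℕ} → Graph n → Subset n → Fin n → Fin n → Set
Witness G D x y = y ∈ D × y ≢ x × Dist≤2 G x y

IsSTDS : {n : ℕ} → Graph n → Subset n → Set
IsSTDS {n} G D =
  (∀ (v : Fin n) → v ∉ D → ∃[ u ] (u ∈ D × Adj G v u)) ×
  (∀ (x : Fin n) → x ∈ D → ∃[ y ] Witness G D x y)

IsMinSTDS : {n : ℕ} → Graph n → Subset n → Set
IsMinSTDS {n} G D = IsSTDS G D × (∀ (D' : Subset n) → IsSTDS G D' → ∣ D ∣ ≤ ∣ D' ∣)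

GammaT2 : {n : ℕ} → Graph n → ℕ → Set
GammaT2 {n} G k = Σ (Subset n) λ D → IsMinSTDS G D × ∣ D ∣ ≡ k

-- H is (isomorphic to) the graph obtained from G by contracting the edge xy:
-- f is the quotient map identifying exactly x and y.
IsContraction : {n : ℕ} → Graph (suc n) → Fin (suc n) → Fin (suc n) → Graph n → Set
IsContraction {n} G x y H = Σ (Fin (suc n) → Fin n) λ f →
  Adj G x y ×
  f x ≡ f y ×
  (∀ u v → f u ≡ f v → u ≡ v ⊎ ((u ≡ x × v ≡ y) ⊎ (u ≡ y × v ≡ x))) ×
  (∀ a → ∃[ u ] (f u ≡ a)) ×
  (∀ a b → Adj H a b ⇔ (a ≢ b × ∃[ u ] ∃[ v ] (f u ≡ a × f v ≡ b × Adj G u v)))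

data Contracts : {m n : ℕ} → Graph m → ℕ → Graph n → Set₁ where
  done : ∀ {m} {G : Graph m} → Contracts G 0 G
  step : ∀ {m n k} {G : Graph (suc m)} {x y : Fin (suc m)} {G' : Graph m} {H : Graph n} →
         IsContraction G x y G' → Contracts G' k H → Contracts G (suc k) H

-- Contracting an edge lowers γt2 by at most one: a semitotal dominating set S of G/kr lifts
-- to the preimage of S, plus one end of kr when the merged vertex is not in S. Conversely,
-- when contracted edges lie around a vertex of a minimum semitotal dominating set D, the
-- image of D is again semitotal dominating as long as the merged vertex keeps a witness,
-- and every contracted vertex of D other than the kept one is lost.
-- In case (ii), with witnesses y₁ ≠ y₂ of x, contract x y₁, or x c for the middle vertex c
-- of an x–c–y₁ path if c ∈ D, or else x c and then the merged vertex with y₁; y₂ stays a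
-- witness. In case (i), with x, y ∈ D adjacent, contract x y if another vertex of D is
-- within distance two of x or y. Otherwise connectivity yields an edge u v leaving the
-- distance-two neighbourhood N of {x, y}, with s–p–u for some s ∈ {x, y}; the dominator d
-- of u lies in D outside N, and contracting s p and then the merged vertex with the other
-- vertex t of {x, y} puts d at distance two (through u) from the merged vertex.
-- Two contractions lower γt2 by at least one and each by at most one, so γt2 = |D| − 1
-- after the first or after the second.
{-# OPTIONS --safe #-}
module Submission where

open import Defs
open import Data.Nat using (ℕ; zero; suc; _≤_; _<_; _∸_; z≤n; s≤s; s≤s⁻¹; _≤?_)
open import Data.Nat.Properties using (≤-reflexive; ≤-trans; ≤-antisym; n≤1+n; ≰⇒>; module ≤-Reasoning)
open import Data.Bool.Properties using (¬-not)
open import Data.Fin using (Fin; zero; suc; punchIn; punchOut; _≟_)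
open import Data.Fin.Properties using (punchOut-cong; punchOut-injective; punchIn-punchOut; punchOut-punchIn; punchInᵢ≢i; any?; all?)
open import Data.Fin.Subset using (Subset; _∈_; _∉_; ∣_∣; inside; outside; _∪_; ⁅_⁆)
open import Data.Fin.Subset.Properties using (_∈?_; anySubset?; ∣p∣≤n; ∪-identityʳ; p⊆q⇒∣p∣≤∣q∣; x∈p∪q⁺; x∈p∪q⁻; x∈⁅x⁆; x∈⁅y⁆⇒x≡y; ∣⁅x⁆∣≡1)
open import Data.Vec using (_∷_; lookup; insertAt; removeAt)
open import Data.Vec.Properties using ([]=⇒lookup; lookup⇒[]=; insertAt-lookup; insertAt-punchIn; insertAt-removeAt; removeAt-punchOut)
open import Data.Product using (Σ; ∃-syntax; _×_; _,_; proj₁; proj₂)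
open import Data.Sum using (_⊎_; inj₁; inj₂; [_,_]′; swap)
open import Function using (_∘_; id)
open import Function.Bundles using (mk⇔)
open import Relation.Nullary using (¬_; Dec; yes; no; contradiction)
open import Relation.Nullary.Decidable using (_×-dec_; _⊎-dec_; _→-dec_; ¬?)
open import Relation.Unary using (Decidable)
open import Relation.Binary.PropositionalEquality as ≡ using (_≡_; _≢_; refl; trans; cong; subst; module ≡-Reasoning)

adj⇒≢ : ∀ {n} (G : Graph n) {u v} → Adj G u v → u ≢ v
adj⇒≢ G u~v refl = irrefl G u~v

dist≤2? : ∀ {n} (G : Graph n) u v → Dec (Dist≤2 G u v)
dist≤2? G u v = adj? G u v ⊎-dec any? (λ z → adj? G u z ×-dec adj? G z v)

isSTDS? : ∀ {n} (G : Graph n) (D : Subset n) → Dec (IsSTDS G D)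
isSTDS? G D =
  all? (λ v → ¬? (v ∈? D) →-dec any? (λ u → (u ∈? D) ×-dec adj? G v u)) ×-dec
  all? (λ x → (x ∈? D) →-dec any? (λ y → (y ∈? D) ×-dec (¬? (y ≟ x) ×-dec dist≤2? G x y)))

boundary-edge : ∀ {n} (G : Graph n) {P : Fin n → Set} → Decidable P →
                ∀ {a b} → Reach G a b → P a → ¬ P b → ∃[ u ] ∃[ v ] (P u × ¬ P v × Adj G u v)
boundary-edge G P? here Pa ¬Pb = contradiction Pa ¬Pb
boundary-edge G P? (step {v = c} a~c c↝b) Pa ¬Pb with P? c
... | yes Pc = boundary-edge G P? c↝b Pc ¬Pb
... | no ¬Pc = _ , c , Pa , ¬Pc , a~c

∣insertAt-inside∣ : ∀ {n} (p : Subset n) i → ∣ insertAt p i inside ∣ ≡ suc ∣ p ∣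
∣insertAt-inside∣ p zero = refl
∣insertAt-inside∣ (inside ∷ p) (suc i) = cong suc (∣insertAt-inside∣ p i)
∣insertAt-inside∣ (outside ∷ p) (suc i) = ∣insertAt-inside∣ p i

∣insertAt-outside∣ : ∀ {n} (p : Subset n) i → ∣ insertAt p i outside ∣ ≡ ∣ p ∣
∣insertAt-outside∣ p zero = refl
∣insertAt-outside∣ (inside ∷ p) (suc i) = cong suc (∣insertAt-outside∣ p i)
∣insertAt-outside∣ (outside ∷ p) (suc i) = ∣insertAt-outside∣ p i

∣p∣≤∣insertAt∣ : ∀ {n} (p : Subset n) i b → ∣ p ∣ ≤ ∣ insertAt p i b ∣
∣p∣≤∣insertAt∣ p i inside = ≤-trans (n≤1+n _) (≤-reflexive (≡.sym (∣insertAt-inside∣ p i)))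
∣p∣≤∣insertAt∣ p i outside = ≤-reflexive (≡.sym (∣insertAt-outside∣ p i))

∣insertAt∣≤ : ∀ {n} (p : Subset n) i b → ∣ insertAt p i b ∣ ≤ suc ∣ p ∣
∣insertAt∣≤ p i inside = ≤-reflexive (∣insertAt-inside∣ p i)
∣insertAt∣≤ p i outside = ≤-trans (≤-reflexive (∣insertAt-outside∣ p i)) (n≤1+n _)

∣removeAt∣≤ : ∀ {n} (p : Subset (suc n)) i → ∣ removeAt p i ∣ ≤ ∣ p ∣
∣removeAt∣≤ p i = begin
  ∣ removeAt p i ∣                           ≤⟨ ∣p∣≤∣insertAt∣ (removeAt p i) i (lookup p i) ⟩
  ∣ insertAt (removeAt p i) i (lookup p i) ∣ ≡⟨ cong ∣_∣ (insertAt-removeAt p i) ⟩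
  ∣ p ∣                                      ∎
  where open ≤-Reasoning

∈⇒∣removeAt∣< : ∀ {n} (p : Subset (suc n)) {i} → i ∈ p → ∣ removeAt p i ∣ < ∣ p ∣
∈⇒∣removeAt∣< p {i} i∈p = ≤-reflexive (begin
  suc ∣ removeAt p i ∣                       ≡⟨ ∣insertAt-inside∣ (removeAt p i) i ⟨
  ∣ insertAt (removeAt p i) i inside ∣       ≡⟨ cong (∣_∣ ∘ insertAt (removeAt p i) i) ([]=⇒lookup i∈p) ⟨
  ∣ insertAt (removeAt p i) i (lookup p i) ∣ ≡⟨ cong ∣_∣ (insertAt-removeAt p i) ⟩
  ∣ p ∣                                      ∎)
  where open ≡-Reasoning

∣p∪⁅x⁆∣≤1+∣p∣ : ∀ {n} (p : Subset n) x → ∣ p ∪ ⁅ x ⁆ ∣ ≤ suc ∣ p ∣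
∣p∪⁅x⁆∣≤1+∣p∣ (inside ∷ p) zero = s≤s (≤-trans (≤-reflexive (cong ∣_∣ (∪-identityʳ p))) (n≤1+n _))
∣p∪⁅x⁆∣≤1+∣p∣ (outside ∷ p) zero = s≤s (≤-reflexive (cong ∣_∣ (∪-identityʳ p)))
∣p∪⁅x⁆∣≤1+∣p∣ (inside ∷ p) (suc x) = s≤s (∣p∪⁅x⁆∣≤1+∣p∣ p x)
∣p∪⁅x⁆∣≤1+∣p∣ (outside ∷ p) (suc x) = ∣p∪⁅x⁆∣≤1+∣p∣ p x

∃-third : ∀ {n} (D : Subset n) {x y} → 3 ≤ ∣ D ∣ → ∃[ w ] (w ∈ D × w ≢ x × w ≢ y)
∃-third D {x} {y} 3≤∣D∣ with any? (λ w → (w ∈? D) ×-dec (¬? (w ≟ x) ×-dec ¬? (w ≟ y)))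
... | yes found = found
... | no none = contradiction (≤-trans 3≤∣D∣ ∣D∣≤2) λ { (s≤s (s≤s ())) }
  where
  D⊆⁅x⁆∪⁅y⁆ : ∀ {v} → v ∈ D → v ∈ ⁅ x ⁆ ∪ ⁅ y ⁆
  D⊆⁅x⁆∪⁅y⁆ {v} v∈D with v ≟ x | v ≟ y
  ... | yes refl | _        = x∈p∪q⁺ (inj₁ (x∈⁅x⁆ v))
  ... | no _     | yes refl = x∈p∪q⁺ (inj₂ (x∈⁅x⁆ v))
  ... | no v≢x   | no v≢y   = contradiction (v , v∈D , v≢x , v≢y) none

  ∣D∣≤2 : ∣ D ∣ ≤ 2
  ∣D∣≤2 = begin
    ∣ D ∣             ≤⟨ p⊆q⇒∣p∣≤∣q∣ D⊆⁅x⁆∪⁅y⁆ ⟩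
    ∣ ⁅ x ⁆ ∪ ⁅ y ⁆ ∣ ≤⟨ ∣p∪⁅x⁆∣≤1+∣p∣ ⁅ x ⁆ y ⟩
    suc ∣ ⁅ x ⁆ ∣     ≡⟨ cong suc (∣⁅x⁆∣≡1 x) ⟩
    2                 ∎
    where open ≤-Reasoning

-- Abstracts a sequence of contractions of edges around h.
record IsCollapse {a b} (G : Graph a) (H : Graph b) (F : Fin a → Fin b) (h : Fin a) : Set where
  field
    adj-preserved   : ∀ {u v} → Adj G u v → F u ≢ F v → Adj H (F u) (F v)
    merges-into-hub : ∀ {u v} → F u ≡ F v → u ≡ v ⊎ F u ≡ F h
    surjective      : ∀ c → ∃[ u ] (F u ≡ c)

  dist≤2-preserved : ∀ {u v} → Dist≤2 G u v → F u ≢ F v → Dist≤2 H (F u) (F v)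
  dist≤2-preserved (inj₁ u~v) Fu≢Fv = inj₁ (adj-preserved u~v Fu≢Fv)
  dist≤2-preserved {u} {v} (inj₂ (z , u~z , z~v)) Fu≢Fv with F z ≟ F u | F z ≟ F v
  ... | yes Fz≡Fu | _ =
    inj₁ (subst (λ a → Adj H a (F v)) Fz≡Fu (adj-preserved z~v (Fu≢Fv ∘ trans (≡.sym Fz≡Fu))))
  ... | no _ | yes Fz≡Fv =
    inj₁ (subst (Adj H (F u)) Fz≡Fv (adj-preserved u~z (λ Fu≡Fz → Fu≢Fv (trans Fu≡Fz Fz≡Fv))))
  ... | no Fz≢Fu | no Fz≢Fv = inj₂ (F z , adj-preserved u~z (Fz≢Fu ∘ ≡.sym) , adj-preserved z~v Fz≢Fv)

  image-isSTDS : ∀ {D D'} → IsSTDS G D →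
                 (∀ {u} → u ∈ D → F u ∈ D') → (∀ {a} → a ∈ D' → ∃[ u ] (u ∈ D × F u ≡ a)) →
                 ∀ {c y} → F c ≡ F h → y ∈ D → F y ≢ F h → Dist≤2 G c y → IsSTDS H D'
  image-isSTDS {D} {D'} (dominated , witnessed) D→D' D'→D {c} {y} Fc≡Fh y∈D Fy≢Fh c-y =
    dominates , witnesses
    where
    dominates : ∀ a → a ∉ D' → ∃[ b ] (b ∈ D' × Adj H a b)
    dominates a a∉D' with surjective a
    ... | v , refl with dominated v (a∉D' ∘ D→D')
    ...   | u , u∈D , v~u =
      F u , D→D' u∈D , adj-preserved v~u (λ Fv≡Fu → a∉D' (subst (_∈ D') (≡.sym Fv≡Fu) (D→D' u∈D)))

    hub-witness : Dist≤2 H (F h) (F y)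
    hub-witness = subst (λ a → Dist≤2 H a (F y)) Fc≡Fh
                    (dist≤2-preserved c-y (λ Fc≡Fy → Fy≢Fh (trans (≡.sym Fc≡Fy) Fc≡Fh)))

    witnesses : ∀ a → a ∈ D' → ∃[ b ] Witness H D' a b
    witnesses a a∈D' with D'→D a∈D'
    ... | x , x∈D , refl with F x ≟ F h
    ...   | yes Fx≡Fh =
      F y , D→D' y∈D , (λ Fy≡Fx → Fy≢Fh (trans Fy≡Fx Fx≡Fh)) ,
      subst (λ a → Dist≤2 H a (F y)) (≡.sym Fx≡Fh) hub-witness
    ...   | no Fx≢Fh with witnessed x x∈D
    ...     | w , w∈D , w≢x , x-w = F w , D→D' w∈D , Fw≢Fx , dist≤2-preserved x-w (Fw≢Fx ∘ ≡.sym)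
      where
      Fw≢Fx : F w ≢ F x
      Fw≢Fx Fw≡Fx with merges-into-hub Fw≡Fx
      ... | inj₁ w≡x   = w≢x w≡x
      ... | inj₂ Fw≡Fh = Fx≢Fh (trans (≡.sym Fw≡Fx) Fw≡Fh)

∘-isCollapse : ∀ {a b c} {G : Graph a} {H₁ : Graph b} {H₂ : Graph c} {F₁ F₂ h} →
               IsCollapse G H₁ F₁ h → IsCollapse H₁ H₂ F₂ (F₁ h) → IsCollapse G H₂ (F₂ ∘ F₁) h
∘-isCollapse {F₁ = F₁} {F₂} {h} c₁ c₂ = record
  { adj-preserved   = λ u~v FFu≢FFv → C₂.adj-preserved (C₁.adj-preserved u~v (FFu≢FFv ∘ cong F₂)) FFu≢FFv
  ; merges-into-hub = into-hub
  ; surjective      = λ a → let (u₁ , F₂u₁≡a) = C₂.surjective a ; (u , F₁u≡u₁) = C₁.surjective u₁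
                            in u , trans (cong F₂ F₁u≡u₁) F₂u₁≡a
  }
  where
  module C₁ = IsCollapse c₁
  module C₂ = IsCollapse c₂
  into-hub : ∀ {u v} → F₂ (F₁ u) ≡ F₂ (F₁ v) → u ≡ v ⊎ F₂ (F₁ u) ≡ F₂ (F₁ h)
  into-hub FFu≡FFv with C₂.merges-into-hub FFu≡FFv
  ... | inj₂ at-hub = inj₂ at-hub
  ... | inj₁ Fu≡Fv with C₁.merges-into-hub Fu≡Fv
  ...   | inj₁ u≡v   = inj₁ u≡v
  ...   | inj₂ at-hub = inj₂ (cong F₂ at-hub)

-- The contraction of k r keeps k and deletes r.
module Contraction {n : ℕ} (G : Graph (suc n)) {k r : Fin (suc n)} (k~r : Adj G k r) where

  End : Fin (suc n) → Set
  End u = u ≡ k ⊎ u ≡ r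

  end? : ∀ u → Dec (End u)
  end? u = (u ≟ k) ⊎-dec (u ≟ r)

  r≢k : r ≢ k
  r≢k = adj⇒≢ G (sym G k~r)

  quot : Fin (suc n) → Fin n
  quot u with r ≟ u
  ... | yes _   = punchOut r≢k
  ... | no r≢u = punchOut r≢u

  quot-punchOut : ∀ {u} (r≢u : r ≢ u) → quot u ≡ punchOut r≢u
  quot-punchOut {u} r≢u with r ≟ u
  ... | yes r≡u = contradiction r≡u r≢u
  ... | no _    = punchOut-cong r refl

  quot-r≡quot-k : quot r ≡ quot k
  quot-r≡quot-k with r ≟ r
  ... | yes _   = ≡.sym (quot-punchOut r≢k)
  ... | no r≢r = contradiction refl r≢r

  quot-end : ∀ {u} → End u → quot u ≡ quot k
  quot-end (inj₁ refl) = refl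
  quot-end (inj₂ refl) = quot-r≡quot-k

  quot-punchIn : ∀ a → quot (punchIn r a) ≡ a
  quot-punchIn a = trans (quot-punchOut (punchInᵢ≢i r a ∘ ≡.sym)) (punchOut-punchIn r)

  quot-fibre : ∀ {u v} → quot u ≡ quot v → u ≡ v ⊎ (End u × End v)
  -- Abstracting r ≟ u and r ≟ v also unfolds quot in eq, leaving an equation between punchOuts.
  quot-fibre {u} {v} eq with r ≟ u | r ≟ v
  ... | yes refl | yes refl = inj₁ refl
  ... | yes refl | no r≢v  = inj₂ (inj₂ refl , inj₁ (≡.sym (punchOut-injective r≢k r≢v eq)))
  ... | no r≢u  | yes refl = inj₂ (inj₁ (punchOut-injective r≢u r≢k eq) , inj₂ refl)
  ... | no r≢u  | no r≢v  = inj₁ (punchOut-injective r≢u r≢v eq)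

  quot-injectiveˡ : ∀ {u v} → ¬ End u → quot u ≡ quot v → u ≡ v
  quot-injectiveˡ ¬end eq with quot-fibre eq
  ... | inj₁ u≡v        = u≡v
  ... | inj₂ (end , _) = contradiction end ¬end

  quot≡quot-k⇒End : ∀ {u} → quot u ≡ quot k → End u
  quot≡quot-k⇒End eq with quot-fibre eq
  ... | inj₁ u≡k        = inj₁ u≡k
  ... | inj₂ (end , _) = end

  ends-adjacent : ∀ {u v} → End u → End v → u ≢ v → Adj G u v
  ends-adjacent (inj₁ refl) (inj₁ refl) u≢v = contradiction refl u≢v
  ends-adjacent (inj₁ refl) (inj₂ refl) _   = k~r
  ends-adjacent (inj₂ refl) (inj₁ refl) _   = sym G k~r
  ends-adjacent (inj₂ refl) (inj₂ refl) u≢v = contradiction refl u≢v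

  other-end : ∀ {u} → End u → ∃[ o ] (End o × Adj G u o)
  other-end (inj₁ refl) = r , inj₂ refl , k~r
  other-end (inj₂ refl) = k , inj₁ refl , sym G k~r

  contracted : Graph n
  contracted = record
    { Adj    = λ a b → a ≢ b × ∃[ u ] ∃[ v ] (quot u ≡ a × quot v ≡ b × Adj G u v)
    ; adj?   = λ a b → ¬? (a ≟ b) ×-dec
                 any? (λ u → any? (λ v → (quot u ≟ a) ×-dec ((quot v ≟ b) ×-dec adj? G u v)))
    ; sym    = λ { (a≢b , u , v , qu , qv , u~v) → a≢b ∘ ≡.sym , v , u , qv , qu , sym G u~v }
    ; irrefl = λ { (a≢a , _) → a≢a refl }
    }

  isContraction : IsContraction G k r contracted
  isContraction = quot , k~r , ≡.sym quot-r≡quot-k , fibre , (λ a → punchIn r a , quot-punchIn a) ,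
                  λ _ _ → mk⇔ id id
    where
    fibre : ∀ u v → quot u ≡ quot v → u ≡ v ⊎ ((u ≡ k × v ≡ r) ⊎ (u ≡ r × v ≡ k))
    fibre u v eq with quot-fibre eq
    ... | inj₁ u≡v                      = inj₁ u≡v
    ... | inj₂ (inj₁ refl , inj₁ refl) = inj₁ refl
    ... | inj₂ (inj₁ u≡k  , inj₂ v≡r)  = inj₂ (inj₁ (u≡k , v≡r))
    ... | inj₂ (inj₂ u≡r  , inj₁ v≡k)  = inj₂ (inj₂ (u≡r , v≡k))
    ... | inj₂ (inj₂ refl , inj₂ refl) = inj₁ refl

  adj-quot : ∀ {u v} → Adj G u v → quot u ≢ quot v → Adj contracted (quot u) (quot v)
  adj-quot {u} {v} u~v qu≢qv = qu≢qv , u , v , refl , refl , u~v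

  image : Subset (suc n) → Subset n
  image D = removeAt D r

  ∈-image-off-r : ∀ {D u} → r ≢ u → u ∈ D → quot u ∈ image D
  ∈-image-off-r {D} {u} r≢u u∈D = lookup⇒[]= (quot u) (image D) (begin
    lookup (image D) (quot u)       ≡⟨ cong (lookup (image D)) (quot-punchOut r≢u) ⟩
    lookup (image D) (punchOut r≢u) ≡⟨ removeAt-punchOut D r≢u ⟩
    lookup D u                      ≡⟨ []=⇒lookup u∈D ⟩
    inside                          ∎)
    where open ≡-Reasoning

  ∈-image : ∀ {D u} → k ∈ D → u ∈ D → quot u ∈ image D
  ∈-image {D} {u} k∈D u∈D with u ≟ r
  ... | yes refl = subst (_∈ image D) (≡.sym quot-r≡quot-k) (∈-image-off-r r≢k k∈D)
  ... | no u≢r  = ∈-image-off-r (u≢r ∘ ≡.sym) u∈D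

  image-⊆-quot : ∀ {D a} → a ∈ image D → ∃[ u ] (u ∈ D × quot u ≡ a)
  image-⊆-quot {D} {a} a∈ = punchIn r a , lookup⇒[]= (punchIn r a) D (begin
    lookup D (punchIn r a)            ≡⟨ removeAt-punchOut D r≢r↑a ⟨
    lookup (image D) (punchOut r≢r↑a) ≡⟨ cong (lookup (image D)) (punchOut-punchIn r) ⟩
    lookup (image D) a                ≡⟨ []=⇒lookup a∈ ⟩
    inside                            ∎) , quot-punchIn a
    where
    open ≡-Reasoning
    r≢r↑a : r ≢ punchIn r a
    r≢r↑a = punchInᵢ≢i r a ∘ ≡.sym

  preimage : Subset n → Subset (suc n)
  preimage S = insertAt S r (lookup S (quot k))

  lookup-preimage : ∀ S u → lookup (preimage S) u ≡ lookup S (quot u)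
  lookup-preimage S u with u ≟ r
  ... | yes refl = trans (insertAt-lookup S r _) (cong (lookup S) (≡.sym quot-r≡quot-k))
  ... | no u≢r  = begin
    lookup (preimage S) u                          ≡⟨ cong (lookup (preimage S)) (punchIn-punchOut r≢u) ⟨
    lookup (preimage S) (punchIn r (punchOut r≢u)) ≡⟨ insertAt-punchIn S r _ (punchOut r≢u) ⟩
    lookup S (punchOut r≢u)                        ≡⟨ cong (lookup S) (quot-punchOut r≢u) ⟨
    lookup S (quot u)                              ∎
    where
    open ≡-Reasoning
    r≢u : r ≢ u
    r≢u = u≢r ∘ ≡.sym

  ∈-preimage⁺ : ∀ {S u} → quot u ∈ S → u ∈ preimage S
  ∈-preimage⁺ {S} {u} qu∈S = lookup⇒[]= u (preimage S) (trans (lookup-preimage S u) ([]=⇒lookup qu∈S))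

  ∈-preimage⁻ : ∀ {S u} → u ∈ preimage S → quot u ∈ S
  ∈-preimage⁻ {S} {u} u∈ = lookup⇒[]= (quot u) S (trans (≡.sym (lookup-preimage S u)) ([]=⇒lookup u∈))

  ∣preimage∣≤1+∣S∣ : ∀ S → ∣ preimage S ∣ ≤ suc ∣ S ∣
  ∣preimage∣≤1+∣S∣ S = ∣insertAt∣≤ S r _

  ∣preimage∣≡∣S∣ : ∀ {S} → quot k ∉ S → ∣ preimage S ∣ ≡ ∣ S ∣
  ∣preimage∣≡∣S∣ {S} qk∉S =
    trans (cong (∣_∣ ∘ insertAt S r) (¬-not (qk∉S ∘ lookup⇒[]= (quot k) S))) (∣insertAt-outside∣ S r)

  lifted : Subset n → Fin (suc n) → Subset (suc n)
  lifted S e = preimage S ∪ ⁅ e ⁆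

  ∈-lifted⁺ : ∀ {S e u} → quot u ∈ S → u ∈ lifted S e
  ∈-lifted⁺ qu∈S = x∈p∪q⁺ (inj₁ (∈-preimage⁺ qu∈S))

  e∈lifted : ∀ {S} e → e ∈ lifted S e
  e∈lifted e = x∈p∪q⁺ (inj₂ (x∈⁅x⁆ e))

  ∈-lifted⁻ : ∀ {S e u} → u ∈ lifted S e → quot u ∈ S ⊎ u ≡ e
  ∈-lifted⁻ {S} {e} u∈ with x∈p∪q⁻ (preimage S) ⁅ e ⁆ u∈
  ... | inj₁ u∈pre = inj₁ (∈-preimage⁻ u∈pre)
  ... | inj₂ u∈⁅e⁆ = inj₂ (x∈⁅y⁆⇒x≡y e u∈⁅e⁆)

  adj-lift : ∀ {a b} → Adj contracted a b → ∃[ u ] ∃[ v ] (quot u ≡ a × quot v ≡ b × Adj G u v)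
  adj-lift = proj₂

  adj-end⇒dist≤2 : ∀ {x z e} → Adj G x z → End z → End e → Dist≤2 G x e
  adj-end⇒dist≤2 {z = z} {e} x~z end-z end-e with z ≟ e
  ... | yes refl = inj₁ x~z
  ... | no z≢e  = inj₂ (z , x~z , ends-adjacent end-z end-e z≢e)

  dist≤2-lift : ∀ {x b} → ¬ End x → Dist≤2 contracted (quot x) b →
                (∃[ w ] (quot w ≡ b × Dist≤2 G x w)) ⊎ (∃[ z ] (Adj G x z × End z))
  dist≤2-lift ¬end (inj₁ (_ , u , v , qu , qv , u~v)) with quot-injectiveˡ ¬end (≡.sym qu)
  ... | refl = inj₁ (v , qv , inj₁ u~v)
  dist≤2-lift ¬end (inj₂ (_ , (_ , u , w₁ , qu , qw₁ , u~w₁) , (_ , w₂ , v , qw₂ , qv , w₂~v)))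
    with quot-injectiveˡ ¬end (≡.sym qu) | w₁ ≟ w₂
  ... | refl | yes refl = inj₁ (v , qv , inj₂ (w₁ , u~w₁ , w₂~v))
  ... | refl | no w₁≢w₂ with quot-fibre (trans qw₁ (≡.sym qw₂))
  ...   | inj₁ w₁≡w₂      = contradiction w₁≡w₂ w₁≢w₂
  ...   | inj₂ (end , _) = inj₂ (w₁ , u~w₁ , end)

  lifted-isSTDS : ∀ {S e} → IsSTDS contracted S → End e →
                  quot k ∈ S ⊎ ∃[ v ] (v ∈ lifted S e × Adj G e v) → IsSTDS G (lifted S e)
  lifted-isSTDS {S} {e} (dominated , witnessed) end-e e-witnessed = dominates , witnesses
    where
    dominates : ∀ v → v ∉ lifted S e → ∃[ u ] (u ∈ lifted S e × Adj G v u)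
    dominates v v∉L with dominated (quot v) (v∉L ∘ ∈-lifted⁺)
    ... | a , a∈S , qv~a with adj-lift qv~a
    ...   | u , w , qu , qw , u~w with u ≟ v
    ...     | yes refl = w , ∈-lifted⁺ (subst (_∈ S) (≡.sym qw) a∈S) , u~w
    ...     | no u≢v with quot-fibre qu
    ...       | inj₁ u≡v          = contradiction u≡v u≢v
    ...       | inj₂ (_ , end-v) = e , e∈lifted e , ends-adjacent end-v end-e λ { refl → v∉L (e∈lifted e) }

    witness-of-preimage : ∀ {x} → quot x ∈ S → ∃[ w ] Witness G (lifted S e) x w
    witness-of-preimage {x} qx∈S with end? x
    ... | yes end-x with other-end end-x
    ...   | o , end-o , x~o =
      o , ∈-lifted⁺ (subst (_∈ S) (trans (quot-end end-x) (≡.sym (quot-end end-o))) qx∈S) ,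
      adj⇒≢ G (sym G x~o) , inj₁ x~o
    witness-of-preimage {x} qx∈S | no ¬end-x with witnessed (quot x) qx∈S
    ... | b , b∈S , b≢qx , qx-b with dist≤2-lift ¬end-x qx-b
    ...   | inj₁ (w , qw , x-w) =
      w , ∈-lifted⁺ (subst (_∈ S) (≡.sym qw) b∈S) , (λ { refl → b≢qx (≡.sym qw) }) , x-w
    ...   | inj₂ (z , x~z , end-z) =
      e , e∈lifted e , (λ { refl → ¬end-x end-e }) , adj-end⇒dist≤2 x~z end-z end-e

    witness-of-e : quot e ∉ S → quot k ∈ S ⊎ ∃[ v ] (v ∈ lifted S e × Adj G e v) →
                   ∃[ w ] Witness G (lifted S e) e w
    witness-of-e qe∉S (inj₁ qk∈S)           = contradiction (subst (_∈ S) (≡.sym (quot-end end-e)) qk∈S) qe∉S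
    witness-of-e qe∉S (inj₂ (v , v∈L , e~v)) = v , v∈L , adj⇒≢ G (sym G e~v) , inj₁ e~v

    witnesses : ∀ x → x ∈ lifted S e → ∃[ w ] Witness G (lifted S e) x w
    witnesses x x∈L with quot x ∈? S
    ... | yes qx∈S = witness-of-preimage qx∈S
    ... | no qx∉S with ∈-lifted⁻ x∈L
    ...   | inj₁ qx∈S = contradiction qx∈S qx∉S
    ...   | inj₂ refl = witness-of-e qx∉S e-witnessed

  lift : ∀ {S} → IsSTDS contracted S → ∃[ L ] (IsSTDS G L × ∣ L ∣ ≤ suc ∣ S ∣)
  lift {S} S-stds with quot k ∈? S
  ... | yes qk∈S = lifted S k , lifted-isSTDS S-stds (inj₁ refl) (inj₁ qk∈S) , (begin
    ∣ lifted S k ∣ ≤⟨ p⊆q⇒∣p∣≤∣q∣ lifted⊆preimage ⟩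
    ∣ preimage S ∣ ≤⟨ ∣preimage∣≤1+∣S∣ S ⟩
    suc ∣ S ∣      ∎)
    where
    open ≤-Reasoning
    lifted⊆preimage : ∀ {u} → u ∈ lifted S k → u ∈ preimage S
    lifted⊆preimage u∈ with ∈-lifted⁻ u∈
    ... | inj₁ qu∈S = ∈-preimage⁺ qu∈S
    ... | inj₂ refl = ∈-preimage⁺ qk∈S
  ... | no qk∉S with proj₁ S-stds (quot k) qk∉S
  ...   | a , a∈S , qk~a with adj-lift qk~a
  ...     | u , v , qu , qv , u~v =
    lifted S u ,
    lifted-isSTDS S-stds (quot≡quot-k⇒End qu) (inj₂ (v , ∈-lifted⁺ (subst (_∈ S) (≡.sym qv) a∈S) , u~v)) ,
    (begin
      ∣ lifted S u ∣      ≤⟨ ∣p∪⁅x⁆∣≤1+∣p∣ (preimage S) u ⟩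
      suc ∣ preimage S ∣  ≡⟨ cong suc (∣preimage∣≡∣S∣ qk∉S) ⟩
      suc ∣ S ∣           ∎)
    where open ≤-Reasoning

  isCollapse : IsCollapse G contracted quot k
  isCollapse = record
    { adj-preserved   = adj-quot
    ; merges-into-hub = into-hub
    ; surjective      = λ a → punchIn r a , quot-punchIn a
    }
    where
    into-hub : ∀ {u v} → quot u ≡ quot v → u ≡ v ⊎ quot u ≡ quot k
    into-hub qu≡qv with quot-fibre qu≡qv
    ... | inj₁ u≡v         = inj₁ u≡v
    ... | inj₂ (end-u , _) = inj₂ (quot-end end-u)

contraction-lowers-γt2-by≤1 : ∀ {n} {G : Graph (suc n)} {D k r} → IsMinSTDS G D → (k~r : Adj G k r) →
                              ∀ T → IsSTDS (Contraction.contracted G k~r) T → ∣ D ∣ ≤ suc ∣ T ∣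
contraction-lowers-γt2-by≤1 {G = G} (_ , minimal) k~r T T-stds with Contraction.lift G k~r T-stds
... | L , L-stds , ∣L∣≤1+∣T∣ = ≤-trans (minimal L L-stds) ∣L∣≤1+∣T∣

gammaT2-squeeze : ∀ {b} (H : Graph b) {K} (S : Subset b) → IsSTDS H S → suc ∣ S ∣ ≤ K →
                  (∀ T → IsSTDS H T → K ≤ suc ∣ T ∣) → GammaT2 H (K ∸ 1)
gammaT2-squeeze H {suc K} S S-stds S<K lower =
  S , (S-stds , λ T T-stds → ≤-trans (s≤s⁻¹ S<K) (s≤s⁻¹ (lower T T-stds))) ,
  ≤-antisym (s≤s⁻¹ S<K) (s≤s⁻¹ (lower S S-stds))

gammaT2-one-or-two : ∀ {a b} (H₁ : Graph a) (H₂ : Graph b) {K} →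
                     (∀ T → IsSTDS H₁ T → K ≤ suc ∣ T ∣) →
                     (∀ {S} → IsSTDS H₂ S → ∃[ L ] (IsSTDS H₁ L × ∣ L ∣ ≤ suc ∣ S ∣)) →
                     (D₂ : Subset b) → IsSTDS H₂ D₂ → suc ∣ D₂ ∣ ≤ K →
                     GammaT2 H₁ (K ∸ 1) ⊎ GammaT2 H₂ (K ∸ 1)
gammaT2-one-or-two H₁ H₂ {K} lower₁ lift D₂ D₂-stds D₂<K
  with anySubset? (λ S → isSTDS? H₂ S ×-dec (suc (suc ∣ S ∣) ≤? K))
... | yes (S , S-stds , S+1<K) with lift S-stds
...   | L , L-stds , ∣L∣≤1+∣S∣ = inj₁ (gammaT2-squeeze H₁ L L-stds (≤-trans (s≤s ∣L∣≤1+∣S∣) S+1<K) lower₁)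
gammaT2-one-or-two H₁ H₂ {K} lower₁ lift D₂ D₂-stds D₂<K | no none =
  inj₂ (gammaT2-squeeze H₂ D₂ D₂-stds D₂<K (λ T T-stds → s≤s⁻¹ (≰⇒> (λ T+1<K → none (T , T-stds , T+1<K)))))

Within2Contractions : ∀ {n} → Graph n → ℕ → Set₁
Within2Contractions G k = Σ ℕ λ j → Σ ℕ λ m → Σ (Graph m) λ H → j ≤ 2 × Contracts G j H × GammaT2 H k

within-one : ∀ {n} {G : Graph (suc n)} {k r K} (k~r : Adj G k r) →
             GammaT2 (Contraction.contracted G k~r) K → Within2Contractions G K
within-one {G = G} {k} {r} k~r γ =
  1 , _ , contracted , s≤s z≤n , step {x = k} {y = r} {G' = contracted} isContraction done , γ
  where open Contraction G k~r

within-one-or-two : ∀ {n} {G : Graph (suc (suc n))} {k r K} (k~r : Adj G k r) →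
                    let open Contraction G k~r in ∀ {k′ r′} (k′~r′ : Adj contracted k′ r′) →
                    GammaT2 contracted K ⊎ GammaT2 (Contraction.contracted contracted k′~r′) K →
                    Within2Contractions G K
within-one-or-two k~r k′~r′ (inj₁ γ₁) = within-one k~r γ₁
within-one-or-two {G = G} {k} {r} k~r {k′} {r′} k′~r′ (inj₂ γ₂) =
  2 , _ , C₂.contracted , s≤s (s≤s z≤n) ,
  step {x = k} {y = r} {G' = C₁.contracted} C₁.isContraction
    (step {x = k′} {y = r′} {G' = C₂.contracted} C₂.isContraction done) , γ₂
  where
  module C₁ = Contraction G k~r
  module C₂ = Contraction C₁.contracted k′~r′

module Reduction {m : ℕ} (G : Graph (suc (suc m))) (D : Subset (suc (suc m))) (D-min : IsMinSTDS G D) where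

  one-contraction : ∀ {k r y} (k~r : Adj G k r) → k ∈ D → r ∈ D → y ∈ D → y ≢ k → y ≢ r →
                    Dist≤2 G k y ⊎ Dist≤2 G r y → Within2Contractions G (∣ D ∣ ∸ 1)
  one-contraction {k} {r} {y} k~r k∈D r∈D y∈D y≢k y≢r near =
    within-one k~r
      (gammaT2-squeeze contracted (image D) image-stds (∈⇒∣removeAt∣< D r∈D)
        (contraction-lowers-γt2-by≤1 D-min k~r))
    where
    open Contraction G k~r
    open IsCollapse isCollapse using (image-isSTDS)

    qy≢qk : quot y ≢ quot k
    qy≢qk = [ y≢k , y≢r ]′ ∘ quot≡quot-k⇒End

    image-stds-via : ∀ {c} → End c → Dist≤2 G c y → IsSTDS contracted (image D)
    image-stds-via end-c =
      image-isSTDS (proj₁ D-min) (∈-image k∈D) image-⊆-quot (quot-end end-c) y∈D qy≢qk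

    image-stds : IsSTDS contracted (image D)
    image-stds = [ image-stds-via (inj₁ refl) , image-stds-via (inj₂ refl) ]′ near

  two-contractions : ∀ {s r t y} (s~r : Adj G s r) → Adj G s t ⊎ Adj G r t → t ≢ s → t ≢ r →
                     s ∈ D → t ∈ D → y ∈ D → y ≢ s → y ≢ r → y ≢ t → Dist≤2 G s y ⊎ Dist≤2 G r y →
                     Within2Contractions G (∣ D ∣ ∸ 1)
  two-contractions {s} {r} {t} {y} s~r edge~t t≢s t≢r s∈D t∈D y∈D y≢s y≢r y≢t near =
    within-one-or-two s~r qs~qt
      (gammaT2-one-or-two C₁.contracted C₂.contracted (contraction-lowers-γt2-by≤1 D-min s~r) C₂.lift
        D₂ D₂-stds D₂<D)
    where
    module C₁ = Contraction G s~r

    ¬end₁-t : ¬ C₁.End t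
    ¬end₁-t = [ t≢s , t≢r ]′

    qs~qt-via : ∀ {q} → C₁.End q → Adj G q t → Adj C₁.contracted (C₁.quot s) (C₁.quot t)
    qs~qt-via end-q q~t =
      subst (λ a → Adj C₁.contracted a (C₁.quot t)) (C₁.quot-end end-q)
        (C₁.adj-quot q~t (λ qq≡qt → ¬end₁-t (C₁.quot≡quot-k⇒End (trans (≡.sym qq≡qt) (C₁.quot-end end-q)))))

    qs~qt : Adj C₁.contracted (C₁.quot s) (C₁.quot t)
    qs~qt = [ qs~qt-via (inj₁ refl) , qs~qt-via (inj₂ refl) ]′ edge~t

    module C₂ = Contraction C₁.contracted qs~qt
    open IsCollapse (∘-isCollapse C₁.isCollapse C₂.isCollapse) using (image-isSTDS)

    F : Fin (suc (suc m)) → Fin m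
    F = C₂.quot ∘ C₁.quot

    D₂ : Subset m
    D₂ = C₂.image (C₁.image D)

    D₂⊆F[D] : ∀ {a} → a ∈ D₂ → ∃[ u ] (u ∈ D × F u ≡ a)
    D₂⊆F[D] a∈D₂ with C₂.image-⊆-quot a∈D₂
    ... | b , b∈D₁ , q₂b≡a with C₁.image-⊆-quot b∈D₁
    ...   | u , u∈D , q₁u≡b = u , u∈D , trans (cong C₂.quot q₁u≡b) q₂b≡a

    Fy≢Fs : F y ≢ F s
    Fy≢Fs Fy≡Fs with C₂.quot≡quot-k⇒End Fy≡Fs
    ... | inj₁ q₁y≡q₁s = [ y≢s , y≢r ]′ (C₁.quot≡quot-k⇒End q₁y≡q₁s)
    ... | inj₂ q₁y≡q₁t = y≢t (≡.sym (C₁.quot-injectiveˡ ¬end₁-t (≡.sym q₁y≡q₁t)))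

    D₂-stds-via : ∀ {c} → C₁.End c → Dist≤2 G c y → IsSTDS C₂.contracted D₂
    D₂-stds-via end-c =
      image-isSTDS (proj₁ D-min) (C₂.∈-image (C₁.∈-image s∈D s∈D) ∘ C₁.∈-image s∈D) D₂⊆F[D]
        (cong C₂.quot (C₁.quot-end end-c)) y∈D Fy≢Fs

    D₂-stds : IsSTDS C₂.contracted D₂
    D₂-stds = [ D₂-stds-via (inj₁ refl) , D₂-stds-via (inj₂ refl) ]′ near

    D₂<D : suc ∣ D₂ ∣ ≤ ∣ D ∣
    D₂<D = ≤-trans (∈⇒∣removeAt∣< (C₁.image D) (C₁.∈-image s∈D t∈D)) (∣removeAt∣≤ D r)

  from-two-witnesses : ∀ {x y₁ y₂} → x ∈ D → Witness G D x y₁ → Witness G D x y₂ → y₁ ≢ y₂ →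
                       Within2Contractions G (∣ D ∣ ∸ 1)
  from-two-witnesses x∈D (y₁∈D , y₁≢x , inj₁ x~y₁) (y₂∈D , y₂≢x , x-y₂) y₁≢y₂ =
    one-contraction x~y₁ x∈D y₁∈D y₂∈D y₂≢x (y₁≢y₂ ∘ ≡.sym) (inj₁ x-y₂)
  from-two-witnesses x∈D (y₁∈D , y₁≢x , inj₂ (c , x~c , c~y₁)) (y₂∈D , y₂≢x , x-y₂) y₁≢y₂ with c ∈? D
  ... | yes c∈D = one-contraction x~c x∈D c∈D y₁∈D y₁≢x (adj⇒≢ G (sym G c~y₁)) (inj₁ (inj₂ (c , x~c , c~y₁)))
  ... | no c∉D  = two-contractions x~c (inj₂ c~y₁) y₁≢x (adj⇒≢ G (sym G c~y₁)) x∈D y₁∈D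
                    y₂∈D y₂≢x (λ { refl → c∉D y₂∈D }) (y₁≢y₂ ∘ ≡.sym) (inj₁ x-y₂)

  Near : Fin (suc (suc m)) → Fin (suc (suc m)) → Fin (suc (suc m)) → Set
  Near s t v = Dist≤2 G s v ⊎ Dist≤2 G t v

  near? : ∀ s t v → Dec (Near s t v)
  near? s t v = dist≤2? G s v ⊎-dec dist≤2? G t v

  Far : Fin (suc (suc m)) → Fin (suc (suc m)) → Set
  Far s t = ∀ {w} → w ∈ D → w ≢ s → w ≢ t → ¬ Near s t w

  near-or-far : ∀ s t → (∃[ w ] (w ∈ D × w ≢ s × w ≢ t × Near s t w)) ⊎ Far s t
  near-or-far s t with any? (λ w → (w ∈? D) ×-dec (¬? (w ≟ s) ×-dec (¬? (w ≟ t) ×-dec near? s t w)))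
  ... | yes near = inj₁ near
  ... | no none  = inj₂ λ w∈D w≢s w≢t near-w → none (_ , w∈D , w≢s , w≢t , near-w)

  from-boundary : ∀ {s t u v} → Adj G s t → s ∈ D → t ∈ D → Far s t → Adj G u v → ¬ Near s t v →
                  Dist≤2 G s u → Within2Contractions G (∣ D ∣ ∸ 1)
  from-boundary s~t s∈D t∈D far u~v ¬near-v (inj₁ s~u) = contradiction (inj₁ (inj₂ (_ , s~u , u~v))) ¬near-v
  from-boundary {s} {t} {u} {v} s~t s∈D t∈D far u~v ¬near-v (inj₂ (p , s~p , p~u)) =
    via-dominator (proj₁ (proj₁ D-min) u u∉D)
    where
    u∉D : u ∉ D
    u∉D u∈D = far u∈D (λ { refl → ¬near-v (inj₁ (inj₁ u~v)) }) (λ { refl → ¬near-v (inj₂ (inj₁ u~v)) })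
                (inj₁ (inj₂ (p , s~p , p~u)))

    via-dominator : ∃[ d ] (d ∈ D × Adj G u d) → Within2Contractions G (∣ D ∣ ∸ 1)
    via-dominator (d , d∈D , u~d) =
      two-contractions s~p (inj₁ s~t) (adj⇒≢ G (sym G s~t)) t≢p s∈D t∈D
        d∈D d≢s d≢p d≢t (inj₂ (inj₂ (u , p~u , u~d)))
      where
      t≢p : t ≢ p
      t≢p refl = ¬near-v (inj₂ (inj₂ (u , p~u , u~v)))
      d≢s : d ≢ s
      d≢s refl = ¬near-v (inj₁ (inj₂ (u , sym G u~d , u~v)))
      d≢t : d ≢ t
      d≢t refl = ¬near-v (inj₂ (inj₂ (u , sym G u~d , u~v)))
      d≢p : d ≢ p
      d≢p refl = far d∈D d≢s d≢t (inj₁ (inj₁ s~p))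

  from-adjacent-pair-far : Connected G → 3 ≤ ∣ D ∣ → ∀ {x y} → x ∈ D → y ∈ D → Adj G x y → Far x y →
                           Within2Contractions G (∣ D ∣ ∸ 1)
  from-adjacent-pair-far connected 3≤∣D∣ {x} {y} x∈D y∈D x~y far with ∃-third D {x} {y} 3≤∣D∣
  ... | w , w∈D , w≢x , w≢y
    with boundary-edge G (near? x y) (connected x w) (inj₁ (inj₂ (y , x~y , sym G x~y))) (far w∈D w≢x w≢y)
  ...   | u , v , inj₁ x-u , ¬near-v , u~v = from-boundary x~y x∈D y∈D far u~v ¬near-v x-u
  ...   | u , v , inj₂ y-u , ¬near-v , u~v =
    from-boundary (sym G x~y) y∈D x∈D (λ w∈D w≢y w≢x → far w∈D w≢x w≢y ∘ swap) u~v (¬near-v ∘ swap) y-u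

  from-adjacent-pair : Connected G → 3 ≤ ∣ D ∣ → ∀ {x y} → x ∈ D → y ∈ D → Adj G x y →
                       Within2Contractions G (∣ D ∣ ∸ 1)
  from-adjacent-pair connected 3≤∣D∣ {x} {y} x∈D y∈D x~y with near-or-far x y
  ... | inj₁ (w , w∈D , w≢x , w≢y , near-w) = one-contraction x~y x∈D y∈D w∈D w≢x w≢y near-w
  ... | inj₂ far = from-adjacent-pair-far connected 3≤∣D∣ x∈D y∈D x~y far

lemma2 : ∀ {n : ℕ} (G : Graph n) → Connected G →
         (D : Subset n) → IsMinSTDS G D → 3 ≤ ∣ D ∣ →
         ((∃[ x ] ∃[ y ] (x ∈ D × y ∈ D × Adj G x y)) ⊎
          (∃[ x ] (x ∈ D × ∃[ y₁ ] ∃[ y₂ ] (Witness G D x y₁ × Witness G D x y₂ × y₁ ≢ y₂)))) →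
         Σ ℕ λ j → Σ ℕ λ m → Σ (Graph m) λ H →
           j ≤ 2 × Contracts G j H × GammaT2 H (∣ D ∣ ∸ 1)
lemma2 {zero} G _ D _ 3≤∣D∣ _ = contradiction (≤-trans 3≤∣D∣ (∣p∣≤n D)) λ ()
lemma2 {suc zero} G _ D _ 3≤∣D∣ _ = contradiction (≤-trans 3≤∣D∣ (∣p∣≤n D)) λ { (s≤s ()) }
lemma2 {suc (suc _)} G connected D D-min 3≤∣D∣ (inj₁ (x , y , x∈D , y∈D , x~y)) =
  Reduction.from-adjacent-pair G D D-min connected 3≤∣D∣ x∈D y∈D x~y
lemma2 {suc (suc _)} G _ D D-min _ (inj₂ (x , x∈D , y₁ , y₂ , w₁ , w₂ , y₁≢y₂)) =
  Reduction.from-two-witnesses G D D-min x∈D w₁ w₂ y₁≢y₂
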